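{- Let $\lambda,\mu$ be partitions and let $M\in\mathrm{MLQ}(\mu,n)$ have column content $\lambda'$, i.e. column $c$ contains $\lambda'_c$ balls for every $c$. Then $\rho_N(M)=M(\lambda')$ if and only if $\mathrm{rw}(M)$ is a lattice word.
   Context: A multiline queue of shape $\mu$ on $n$ columns is a tuple $M=(B_1,\dots,B_{\mu_1})$ of subsets of $[n]$ with $|B_r|=\mu'_r$, drawn with rows bottom to top and columns left to right (ball at $(r,j)$ iff $j\in B_r$). $\mathrm{rw}(M)$ records the column number of each ball, scanning rows from bottom to top and each row from left to right; $\mathrm{cw}(M)$ records the row number of each ball, scanning columns left to right, each column top to bottom. A word in positive integers is a lattice word if every prefix contains at least as many letters $i$ as letters $i+1$, for every $i\ge1$. For a partition $\nu$, $M(\nu)=(M_1,\dots,M_{\nu_1})$ with $M_j=\{1,\dots,\nu'_j\}$ (the left-justified multiline queue of shape $\nu$); $M(\lambda')$ has rows $\{1,\dots,\lambda_j\}$ and is padded with empty rows to have $\mu_1$ rows. Collapsing: $\mathrm{Par}_i(w)$ writes "(" for each $i+1$ and ")" for each $i$ of $w$ read left to right, matching iteratively when "(" is immediately followed by ")" or separated only by matched parentheses; a ball of row $i+1$ is unmatched above if its letter is unmatched in $\mathrm{Par}_i(\mathrm{cw}(M))$. $e_i^\star$ moves every ball of row $i+1$ unmatched above to row $i$ (same column). Operators compose right to left, $e^\star_{[a,b]}=e^\star_a\cdots e^\star_b$, and $\rho_N(M)=e^\star_{[1,L-1]}\cdots e^\star_{[1,1]}(M)$ with $L=\mu_1$.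 -}

module Defs where

open import Data.Nat using (ℕ; zero; suc; _+_; _≤_; _∸_; _≤ᵇ_; _≡ᵇ_)
import Data.Bool
import Data.Bool.ListAction
open import Data.Bool using (Bool; true; false; if_then_else_; _∧_; _∨_; not)
open import Data.List using (List; []; _∷_; length; filter; take; concatMap; reverse; allFin)
open import Data.Vec using (Vec; lookup; tabulate)
import Data.Vec as V
open import Relation.Binary.PropositionalEquality using (_≡_)
import Data.List as L
open import Data.Fin using (Fin; toℕ)
open import Data.Product using (_×_; _,_; proj₁; proj₂)
open import Relation.Nullary using (Dec)
import Data.Nat as ℕ

data IsPartition : List ℕ → Set where
  []-part  : IsPartition []
  one-part : ∀ {a} → 1 ≤ a → IsPartition (a ∷ [])
  cons-part : ∀ {a b ν} → b ≤ a → IsPartition (b ∷ ν) → IsPartition (a ∷ b ∷ ν)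

first : List ℕ → ℕ
first []      = 0
first (a ∷ _) = a

-- j-th part ν_j (1-indexed), 0 beyond the length
part : List ℕ → ℕ → ℕ
part []      _             = 0
part (a ∷ ν) zero          = 0
part (a ∷ ν) (suc zero)    = a
part (a ∷ ν) (suc (suc j)) = part ν (suc j)

conj : List ℕ → ℕ → ℕ
conj ν r = length (filter (λ a → r ℕ.≤? a) ν)

-- Multiline queues with L rows on n columns.
-- Row r (1-indexed) is the (toℕ r' + 1)-th entry of the vector;
-- column c (1-indexed) is entry toℕ c' + 1 of each row; true = ball.

MLQ : ℕ → ℕ → Set
MLQ L n = Vec (Vec Bool n) L

ones : ∀ {n} → Vec Bool n → ℕ
ones V.[] = 0
ones (true V.∷ v) = suc (ones v)
ones (false V.∷ v) = ones v

IsMLQ : (μ : List ℕ) (n : ℕ) → MLQ (first μ) n → Set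
IsMLQ μ n M = ∀ (r : Fin (first μ)) → ones (lookup M r) ≡ conj μ (suc (toℕ r))

colCount : ∀ {L n} → MLQ L n → Fin n → ℕ
colCount {L} M c = length (filter (λ r → lookup (lookup M r) c Data.Bool.≟ true) (allFin L))

-- rw(M): rows bottom to top, each row left to right; record column numbers
rw : ∀ {L n} → MLQ L n → List ℕ
rw {L} {n} M = concatMap (λ r → concatMap (λ c → if lookup (lookup M r) c then suc (toℕ c) ∷ [] else []) (allFin n)) (allFin L)

-- cw(M) with the ball's column attached: columns left to right, each
-- column top to bottom; entries (row number, column number)
cwTagged : ∀ {L n} → MLQ L n → List (ℕ × ℕ)
cwTagged {L} {n} M = concatMap (λ c → concatMap (λ r → if lookup (lookup M r) c then (suc (toℕ r) , suc (toℕ c)) ∷ [] else []) (reverse (allFin L))) (allFin n)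

cw : ∀ {L n} → MLQ L n → List ℕ
cw M = L.map proj₁ (cwTagged M)

countL : ℕ → List ℕ → ℕ
countL i w = length (filter (λ a → a ℕ.≟ i) w)

Lattice : List ℕ → Set
Lattice w = ∀ (k i : ℕ) → countL (suc (suc i)) (take k w) ≤ countL (suc i) (take k w)

data Paren : Set where
  opn cls oth : Paren

parOf : ℕ → ℕ → Paren
parOf i a = if a ≡ᵇ suc i then opn else (if a ≡ᵇ i then cls else oth)

-- For each position, flag = true iff it is
-- an unmatched "(". The second component is the number of unmatched ")"
-- in the word (these are the ones available to match a "(" to their left).
unmatchedOpen : List Paren → List Bool × ℕ
unmatchedOpen [] = [] , 0
unmatchedOpen (opn ∷ w) with unmatchedOpen w
... | f , zero  = true ∷ f , zero
... | f , suc k = false ∷ f , k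
unmatchedOpen (cls ∷ w) with unmatchedOpen w
... | f , k = false ∷ f , suc k
unmatchedOpen (oth ∷ w) with unmatchedOpen w
... | f , k = false ∷ f , k

unmatchedCols : ∀ {L n} → ℕ → MLQ L n → List ℕ
unmatchedCols i M = go (cwTagged M) (proj₁ (unmatchedOpen (L.map (λ p → parOf i (proj₁ p)) (cwTagged M))))
  where
  go : List (ℕ × ℕ) → List Bool → List ℕ
  go ((r , c) ∷ ps) (true ∷ fs)  = c ∷ go ps fs
  go ((r , c) ∷ ps) (false ∷ fs) = go ps fs
  go _ _ = []

memb : ℕ → List ℕ → Bool
memb c = Data.Bool.ListAction.any (λ d → d ≡ᵇ c)

estar : ∀ {L n} → ℕ → MLQ L n → MLQ L n
estar {L} {n} i M = tabulate λ r → tabulate λ c →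
  let r₁ = suc (toℕ r) ; c₁ = suc (toℕ c) ; old = lookup (lookup M r) c
      u  = memb c₁ (unmatchedCols i M) in
  if r₁ ≡ᵇ i then old ∨ u else (if r₁ ≡ᵇ suc i then old ∧ not u else old)

-- e^⋆_{[1,b]} = e^⋆_1 ⋯ e^⋆_b  (rightmost applied first)
eInt : ∀ {L n} → ℕ → MLQ L n → MLQ L n
eInt zero    M = M
eInt (suc b) M = eInt b (estar (suc b) M)

rhoUpTo : ∀ {L n} → ℕ → MLQ L n → MLQ L n
rhoUpTo zero    M = M
rhoUpTo (suc k) M = eInt (suc k) (rhoUpTo k M)

rhoN : ∀ {L n} → MLQ L n → MLQ L n
rhoN {L} M = rhoUpTo (L ∸ 1) M

-- M(λ'), padded to L rows: row j (1-indexed) = {1, …, λ_j}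
Mconj : (la : List ℕ) (L n : ℕ) → MLQ L n
Mconj la L n = tabulate λ r → tabulate λ c → suc (toℕ c) ≤ᵇ part la (suc (toℕ r))

{-# OPTIONS --safe #-}
module Submission where

-- Let P_r(c) be the number of balls of column c in rows 1, …, r. Reading rw(M) row by row shows that
-- rw(M) is a lattice word iff P_r(c + 1) ≤ P_r(c) for all r and c (the ballot condition). The operator
-- e_i^⋆ only changes P_i, adding 1 in the columns it moves, which are the columns with a ball in row
-- i + 1 but not in row i and no unmatched ")" of Par_i to their right. This matching rule makes e_i^⋆
-- preserve the ballot condition and also reflect it. Moreover, when the rows below i are justified and
-- the ballot condition holds, no column with a ball in row i and none in row i + 1 lies to the right of
-- such a column, so all of them move. Hence the k-th round e^⋆_{[1,k]} of ρ_N justifies row k + 1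
-- without changing the column content, and ρ_N(M) is the justified queue with column content λ′,
-- namely M(λ′). Conversely M(λ′) satisfies the ballot condition, which ρ_N reflects back to M.

open import Defs
open import Data.Nat using (ℕ; zero; suc; _≤_; _<_; z≤n; s≤s; s≤s⁻¹; _+_; _∸_; _≤ᵇ_; _≡ᵇ_; pred)
open import Data.Nat.Properties
open import Data.Bool using (Bool; true; false; if_then_else_; _∧_; _∨_; not; T)
open import Data.Bool.Properties using (∧-zeroʳ; ∧-identityʳ; ∨-identityʳ)
open import Data.List as List using (List; []; _∷_; _++_; length; filter; take; drop; concatMap; reverse)
open import Data.List.Properties using (++-identityʳ; ++-assoc; concatMap-++; unfold-reverse; filter-++; length-++; take++drop≡id; take-all; take-[])
open import Data.Vec as Vec using (Vec; lookup)
open import Data.Vec.Properties using (lookup∘tabulate; tabulate∘lookup; tabulate-cong)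
open import Data.Fin using (Fin; toℕ; fromℕ<) renaming (zero to fzero; suc to fsuc)
open import Data.Fin.Properties using (toℕ-fromℕ<; toℕ<n)
open import Data.Product using (_×_; _,_; proj₁; proj₂; Σ-syntax)
open import Data.Sum using (_⊎_; inj₁; inj₂)
open import Data.Empty using (⊥-elim)
open import Relation.Nullary using (Dec; ¬_; yes; no; _×-dec_)
open import Relation.Nullary.Decidable using (dec-true; dec-false)
open import Relation.Binary.PropositionalEquality
open import Relation.Binary.Definitions using (tri<; tri≈; tri>)
open import Function using (_∘_; id)
open import Function.Bundles using (_⇔_; mk⇔)

≤ᵇ-true : ∀ {m n} → m ≤ n → (m ≤ᵇ n) ≡ true
≤ᵇ-true {m} {n} = dec-true (m ≤? n)

≤ᵇ-false : ∀ {m n} → n < m → (m ≤ᵇ n) ≡ false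
≤ᵇ-false {m} {n} n<m = dec-false (m ≤? n) (<⇒≱ n<m)

≤ᵇ-true⇒≤ : ∀ {m n} → (m ≤ᵇ n) ≡ true → m ≤ n
≤ᵇ-true⇒≤ {m} {n} e = ≤ᵇ⇒≤ m n (subst T (sym e) _)

≡ᵇ-true : ∀ {m n} → m ≡ n → (m ≡ᵇ n) ≡ true
≡ᵇ-true {m} {n} = dec-true (m ≟ n)

≡ᵇ-false : ∀ {m n} → m ≢ n → (m ≡ᵇ n) ≡ false
≡ᵇ-false {m} {n} = dec-false (m ≟ n)

true≢false : true ≢ false
true≢false ()

∧-true₁ : ∀ {a b} → a ∧ b ≡ true → a ≡ true
∧-true₁ {true} _ = refl

pred< : ∀ {k} → 1 ≤ k → pred k < k
pred< {suc k} _ = n<1+n k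

bit : Bool → ℕ
bit true  = 1
bit false = 0

bit≤1 : ∀ b → bit b ≤ 1
bit≤1 true  = ≤-refl
bit≤1 false = z≤n

-- Multiline queues as 0/1 grids

Grid : Set
Grid = ℕ → ℕ → Bool

-- Rows and columns are read 1-based, as in the paper; a grid is empty outside its box [1, L] × [1, n].
entry : ∀ {n} → Vec Bool n → ℕ → Bool
entry Vec.[]      _             = false
entry (b Vec.∷ v) zero          = false
entry (b Vec.∷ v) (suc zero)    = b
entry (b Vec.∷ v) (suc (suc c)) = entry v (suc c)

ball : ∀ {L n} → MLQ L n → Grid
ball Vec.[]        _             _ = false
ball (row Vec.∷ M) zero          _ = false
ball (row Vec.∷ M) (suc zero)    c = entry row c
ball (row Vec.∷ M) (suc (suc r)) c = ball M (suc r) c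

lookup-entry : ∀ {n} (v : Vec Bool n) c → lookup v c ≡ entry v (suc (toℕ c))
lookup-entry (b Vec.∷ v) fzero    = refl
lookup-entry (b Vec.∷ v) (fsuc c) = lookup-entry v c

lookup-ball : ∀ {L n} (M : MLQ L n) r c → lookup (lookup M r) c ≡ ball M (suc (toℕ r)) (suc (toℕ c))
lookup-ball (row Vec.∷ M) fzero    c = lookup-entry row c
lookup-ball (row Vec.∷ M) (fsuc r) c = lookup-ball M r c

lookup-tabulate² : ∀ {A : Set} {L n} (f : Fin L → Fin n → A) r c →
                   lookup (lookup (Vec.tabulate (λ r → Vec.tabulate (f r))) r) c ≡ f r c
lookup-tabulate² f r c = trans (cong (λ v → lookup v c) (lookup∘tabulate _ r)) (lookup∘tabulate (f r) c)

Vec-ext² : ∀ {A : Set} {L n} (P Q : Vec (Vec A n) L) →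
           (∀ r c → lookup (lookup P r) c ≡ lookup (lookup Q r) c) → P ≡ Q
Vec-ext² P Q eq = ext P Q (λ r → ext (lookup P r) (lookup Q r) (eq r))
  where
  ext : ∀ {B : Set} {m} (u v : Vec B m) → (∀ k → lookup u k ≡ lookup v k) → u ≡ v
  ext u v eq = trans (sym (tabulate∘lookup u)) (trans (tabulate-cong eq) (tabulate∘lookup v))

InRange : ℕ → ℕ → Set
InRange n c = 1 ≤ c × c ≤ n

inRange? : ∀ n c → Dec (InRange n c)
inRange? n c = (1 ≤? c) ×-dec (c ≤? n)

toFin : ∀ {n c} → InRange n c → Σ[ c′ ∈ Fin n ] suc (toℕ c′) ≡ c
toFin {c = suc c} (_ , c≤n) = fromℕ< c≤n , cong suc (toℕ-fromℕ< c≤n)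

entry-inRange : ∀ {n} (v : Vec Bool n) c → entry v c ≡ true → InRange n c
entry-inRange (b Vec.∷ v) (suc zero)    _ = ≤-refl , s≤s z≤n
entry-inRange (b Vec.∷ v) (suc (suc c)) e = s≤s z≤n , s≤s (proj₂ (entry-inRange v (suc c) e))

ball-inBox : ∀ {L n} (M : MLQ L n) r c → ball M r c ≡ true → InRange L r × InRange n c
ball-inBox (row Vec.∷ M) (suc zero)    c e = (≤-refl , s≤s z≤n) , entry-inRange row c e
ball-inBox (row Vec.∷ M) (suc (suc r)) c e with ball-inBox M (suc r) c e
... | (_ , r≤L) , c∈ = (s≤s z≤n , s≤s r≤L) , c∈

ball-outsideColumn : ∀ {L n} (M : MLQ L n) r {c} → ¬ InRange n c → ball M r c ≡ false
ball-outsideColumn M r {c} c∉ with ball M r c in e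
... | true  = ⊥-elim (c∉ (proj₂ (ball-inBox M r c e)))
... | false = refl

ball-outsideRow : ∀ {L n} (M : MLQ L n) {r} c → ¬ InRange L r → ball M r c ≡ false
ball-outsideRow M {r} c r∉ with ball M r c in e
... | true  = ⊥-elim (r∉ (proj₁ (ball-inBox M r c e)))
... | false = refl

-- Column counts, the ballot condition and justified columns

colPrefix : Grid → ℕ → ℕ → ℕ
colPrefix B c zero    = 0
colPrefix B c (suc r) = colPrefix B c r + bit (B (suc r) c)

-- The grid form of the lattice condition on rw.
BallotUpTo : ℕ → Grid → Set
BallotUpTo K B = ∀ r c → r ≤ K → colPrefix B (suc (suc c)) r ≤ colPrefix B (suc c) r

colPrefix≤ : ∀ B c r → colPrefix B c r ≤ r
colPrefix≤ B c zero    = z≤n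
colPrefix≤ B c (suc r) = ≤-trans (+-mono-≤ (colPrefix≤ B c r) (bit≤1 (B (suc r) c))) (≤-reflexive (+-comm r 1))

colPrefix-pred : ∀ B c {r} → 1 ≤ r → colPrefix B c r ≡ colPrefix B c (pred r) + bit (B r c)
colPrefix-pred B c {suc r} _ = refl

colPrefix-mono : ∀ B p q → (∀ r → B r q ≡ true → B r p ≡ true) → ∀ r → colPrefix B q r ≤ colPrefix B p r
colPrefix-mono B p q q⊆p zero    = z≤n
colPrefix-mono B p q q⊆p (suc r) = +-mono-≤ (colPrefix-mono B p q q⊆p r) (bit-mono (q⊆p (suc r)))
  where
  bit-mono : ∀ {a b} → (a ≡ true → b ≡ true) → bit a ≤ bit b
  bit-mono {false}         _   = z≤n
  bit-mono {true}  {true}  _   = ≤-refl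
  bit-mono {true}  {false} a⇒b = ⊥-elim (true≢false (sym (a⇒b refl)))

colPrefix-suc : ∀ B c r → colPrefix B c (suc r) ≡ bit (B 1 c) + colPrefix (λ r → B (suc r)) c r
colPrefix-suc B c zero    = +-comm 0 (bit (B 1 c))
colPrefix-suc B c (suc r) = trans (cong (_+ bit (B (suc (suc r)) c)) (colPrefix-suc B c r)) (+-assoc (bit (B 1 c)) _ _)

colCount-colPrefix : ∀ {L n} (M : MLQ L n) c → colCount M c ≡ colPrefix (ball M) (suc (toℕ c)) L
colCount-colPrefix {L} M c = count L id (λ r → lookup (lookup M r) c) (ball M) (λ r → lookup-ball M r c)
  where
  count : ∀ {X : Set} L (f : Fin L → X) (h : X → Bool) (B : Grid) → (∀ r → h (f r) ≡ B (suc (toℕ r)) (suc (toℕ c))) →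
          length (filter (λ y → h y Data.Bool.≟ true) (List.tabulate f)) ≡ colPrefix B (suc (toℕ c)) L
  count zero    f h B eq = refl
  count (suc L) f h B eq rewrite colPrefix-suc B (suc (toℕ c)) L | eq fzero with B 1 (suc (toℕ c))
  ... | true  = cong suc (count L (f ∘ fsuc) h (λ r → B (suc r)) (eq ∘ fsuc))
  ... | false = count L (f ∘ fsuc) h (λ r → B (suc r)) (eq ∘ fsuc)

JustifiedUpTo : ℕ → Grid → Set
JustifiedUpTo h B = ∀ c r → 1 ≤ r → suc r ≤ h → B (suc r) c ≡ true → B r c ≡ true

-- Rows 1, …, K + 1 are justified except for holes in row j, each directly below the top ball
-- (among rows ≤ K + 1) of its column.
JustifiedUpToHole : ℕ → ℕ → Grid → Set
JustifiedUpToHole K j B = ∀ c r → 1 ≤ r → r ≤ K → B (suc r) c ≡ true →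
                          B r c ≡ true ⊎ (r ≡ j × (r < K → B (suc (suc r)) c ≡ false))

justified⇒holeAtTop : ∀ K B → JustifiedUpTo K B → JustifiedUpToHole K K B
justified⇒holeAtTop K B justified c r 1≤r r≤K ball with m≤n⇒m<n∨m≡n r≤K
... | inj₁ r<K = inj₁ (justified c r 1≤r r<K ball)
... | inj₂ r≡K = inj₂ (r≡K , λ r<K → ⊥-elim (<⇒≢ r<K r≡K))

holeAtZero⇒justified : ∀ K B → JustifiedUpToHole K 0 B → JustifiedUpTo (suc K) B
holeAtZero⇒justified K B hole c r 1≤r r<1+K ball with hole c r 1≤r (s≤s⁻¹ r<1+K) ball
... | inj₁ b       = b
... | inj₂ (r≡0 , _) = ⊥-elim (<⇒≢ 1≤r (sym r≡0))

ballot-chain : ∀ K B → BallotUpTo K B → ∀ r → r ≤ K → ∀ c d → 1 ≤ c → c ≤ d → colPrefix B d r ≤ colPrefix B c r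
ballot-chain K B ballot r r≤K c d 1≤c c≤d with m≤n⇒m<n∨m≡n c≤d
... | inj₂ refl = ≤-refl
... | inj₁ c<d with d
...   | suc (suc d′) = ≤-trans (ballot r d′ r≤K) (ballot-chain K B ballot r r≤K c (suc d′) 1≤c (s≤s⁻¹ c<d))
...   | suc zero     = ⊥-elim (<⇒≱ c<d 1≤c)

filled-below : ∀ (B : Grid) d i → (∀ r → 1 ≤ r → r < i → B (suc r) d ≡ true → B r d ≡ true) →
               B i d ≡ true → ∀ r → 1 ≤ r → r ≤ i → B r d ≡ true
filled-below B d i justified top r 1≤r r≤i = go (i ∸ r) r 1≤r (m∸n+n≡m r≤i)
  where
  go : ∀ k r → 1 ≤ r → k + r ≡ i → B r d ≡ true
  go zero    r _   k+r≡i = subst (λ s → B s d ≡ true) (sym k+r≡i) top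
  go (suc k) r 1≤r k+r≡i = justified r 1≤r (≤-trans (s≤s (m≤n+m r k)) (≤-reflexive k+r≡i))
    (go k (suc r) (s≤s z≤n) (trans (+-suc k r) k+r≡i))

colPrefix-filled : ∀ B d m → (∀ r → 1 ≤ r → r ≤ m → B r d ≡ true) → colPrefix B d m ≡ m
colPrefix-filled B d zero    _      = refl
colPrefix-filled B d (suc m) filled = begin
  colPrefix B d m + bit (B (suc m) d)
    ≡⟨ cong₂ _+_ (colPrefix-filled B d m (λ r 1≤r r≤m → filled r 1≤r (m≤n⇒m≤1+n r≤m)))
                 (cong bit (filled (suc m) (s≤s z≤n) ≤-refl)) ⟩
  m + 1                               ≡⟨ +-comm m 1 ⟩
  suc m                               ∎
  where open ≡-Reasoning

colPrefix<-if-empty : ∀ B c i → 1 ≤ i → B i c ≡ false → colPrefix B c i < i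
colPrefix<-if-empty B c (suc i) _ empty rewrite empty | +-identityʳ (colPrefix B c i) = s≤s (colPrefix≤ B c i)

justified-ball : ∀ B c h → JustifiedUpTo h B → ∀ r → 1 ≤ r → r ≤ h → B r c ≡ (r ≤ᵇ colPrefix B c h)
justified-ball B c zero    _         r 1≤r r≤0 = ⊥-elim (<⇒≱ 1≤r r≤0)
justified-ball B c (suc h) justified r 1≤r r≤h with B (suc h) c in top
... | true = trans (filled r 1≤r r≤h) (sym (≤ᵇ-true (subst (r ≤_) count r≤h)))
  where
  filled : ∀ r → 1 ≤ r → r ≤ suc h → B r c ≡ true
  filled = filled-below B c (suc h) (λ r 1≤r r<h → justified c r 1≤r r<h) top
  count : suc h ≡ colPrefix B c h + 1
  count = trans (sym (colPrefix-filled B c (suc h) filled)) (cong (λ b → colPrefix B c h + bit b) top)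
... | false with m≤n⇒m<n∨m≡n r≤h
...   | inj₁ r<h rewrite +-identityʳ (colPrefix B c h) =
  justified-ball B c h (λ c′ r′ 1≤r′ r′<h → justified c′ r′ 1≤r′ (m≤n⇒m≤1+n r′<h)) r 1≤r (s≤s⁻¹ r<h)
...   | inj₂ refl rewrite +-identityʳ (colPrefix B c h) = trans top (sym (≤ᵇ-false (s≤s (colPrefix≤ B c h))))

-- Moving balls from row i + 1 down to row i

moveCell : ℕ → ℕ → Bool → Bool → Bool
moveCell i r b m = if r ≡ᵇ i then b ∨ m else (if r ≡ᵇ suc i then b ∧ not m else b)

moveCell-other : ∀ i {r} b m → r ≢ i → r ≢ suc i → moveCell i r b m ≡ b
moveCell-other i b m r≢i r≢1+i rewrite ≡ᵇ-false r≢i | ≡ᵇ-false r≢1+i = refl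

moveCell-empty : ∀ i r → moveCell i r false false ≡ false
moveCell-empty i r with r ≡ᵇ i | r ≡ᵇ suc i
... | true  | _     = refl
... | false | true  = refl
... | false | false = refl

Opening : Grid → ℕ → ℕ → Set
Opening B i c = B (suc i) c ≡ true × B i c ≡ false

Closing : Grid → ℕ → ℕ → Set
Closing B i c = B i c ≡ true × B (suc i) c ≡ false

module Move (B B′ : Grid) (i : ℕ) (mv : ℕ → Bool) (1≤i : 1 ≤ i)
  (B′-def : ∀ r c → B′ r c ≡ moveCell i r (B r c) (mv c))
  (mv⇒opening : ∀ c → mv c ≡ true → Opening B i c) where

  B′-other : ∀ {r} c → r ≢ i → r ≢ suc i → B′ r c ≡ B r c
  B′-other {r} c r≢i r≢1+i = trans (B′-def r c) (moveCell-other i (B r c) (mv c) r≢i r≢1+i)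

  B′-at : ∀ c → B′ i c ≡ B i c ∨ mv c
  B′-at c rewrite B′-def i c | ≡ᵇ-true {i} refl = refl

  B′-above : ∀ c → B′ (suc i) c ≡ B (suc i) c ∧ not (mv c)
  B′-above c rewrite B′-def (suc i) c | ≡ᵇ-false {suc i} {i} (>⇒≢ (n<1+n i)) | ≡ᵇ-true {i} refl = refl

  colPrefix-below : ∀ c r → r < i → colPrefix B′ c r ≡ colPrefix B c r
  colPrefix-below c zero    _   = refl
  colPrefix-below c (suc r) r<i = cong₂ _+_ (colPrefix-below c r (<-trans (n<1+n r) r<i))
    (cong bit (B′-other c (<⇒≢ r<i) (<⇒≢ (<-trans r<i (n<1+n i)))))

  colPrefix-at : ∀ c → colPrefix B′ c i ≡ colPrefix B c i + bit (mv c)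
  colPrefix-at c = begin
    colPrefix B′ c i                                          ≡⟨ colPrefix-pred B′ c 1≤i ⟩
    colPrefix B′ c (pred i) + bit (B′ i c)
      ≡⟨ cong₂ _+_ (colPrefix-below c (pred i) (pred< 1≤i)) (cong bit (B′-at c)) ⟩
    colPrefix B c (pred i) + bit (B i c ∨ mv c)               ≡⟨ cong (colPrefix B c (pred i) +_) (bit-∨ (mv c) refl) ⟩
    colPrefix B c (pred i) + (bit (B i c) + bit (mv c))       ≡⟨ +-assoc (colPrefix B c (pred i)) _ _ ⟨
    colPrefix B c (pred i) + bit (B i c) + bit (mv c)         ≡⟨ cong (_+ bit (mv c)) (colPrefix-pred B c 1≤i) ⟨
    colPrefix B c i + bit (mv c)                              ∎
    where
    open ≡-Reasoning
    bit-∨ : ∀ m → mv c ≡ m → bit (B i c ∨ m) ≡ bit (B i c) + bit m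
    bit-∨ false _  = trans (cong bit (∨-identityʳ (B i c))) (sym (+-identityʳ _))
    bit-∨ true  mv rewrite proj₂ (mv⇒opening c mv) = refl

  colPrefix-above : ∀ c k → colPrefix B′ c (suc k + i) ≡ colPrefix B c (suc k + i)
  colPrefix-above c zero = begin
    colPrefix B′ c i + bit (B′ (suc i) c)                     ≡⟨ cong₂ _+_ (colPrefix-at c) (cong bit (B′-above c)) ⟩
    colPrefix B c i + bit (mv c) + bit (B (suc i) c ∧ not (mv c)) ≡⟨ +-assoc (colPrefix B c i) _ _ ⟩
    colPrefix B c i + (bit (mv c) + bit (B (suc i) c ∧ not (mv c))) ≡⟨ cong (colPrefix B c i +_) (bit-∧-not (mv c) refl) ⟩
    colPrefix B c i + bit (B (suc i) c)                       ∎
    where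
    open ≡-Reasoning
    bit-∧-not : ∀ m → mv c ≡ m → bit m + bit (B (suc i) c ∧ not m) ≡ bit (B (suc i) c)
    bit-∧-not false _  = cong bit (∧-identityʳ (B (suc i) c))
    bit-∧-not true  mv rewrite proj₁ (mv⇒opening c mv) = refl
  colPrefix-above c (suc k) = cong₂ _+_ (colPrefix-above c k)
    (cong bit (B′-other c (>⇒≢ (<-trans (n<1+n i) 1+i<r)) (>⇒≢ 1+i<r)))
    where
    1+i<r : suc i < suc (suc k + i)
    1+i<r = s≤s (s≤s (m≤n+m i k))

  colPrefix-unmoved : ∀ c {r} → r ≢ i → colPrefix B′ c r ≡ colPrefix B c r
  colPrefix-unmoved c {r} r≢i with <-cmp r i
  ... | tri< r<i _ _ = colPrefix-below c r r<i
  ... | tri≈ _ r≡i _ = ⊥-elim (r≢i r≡i)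
  ... | tri> _ _ i<r = trans (cong (colPrefix B′ c) r≡) (trans (colPrefix-above c (r ∸ suc i)) (cong (colPrefix B c) (sym r≡)))
    where
    r≡ : r ≡ suc (r ∸ suc i) + i
    r≡ = trans (sym (m∸n+n≡m i<r)) (+-suc (r ∸ suc i) i)

  MovesLeftward : Set
  MovesLeftward = ∀ c → 1 ≤ c → Opening B i c → Opening B i (suc c) → mv (suc c) ≡ true → mv c ≡ true

  StaysBeforeClosing : Set
  StaysBeforeClosing = ∀ c → Opening B i c → Closing B i (suc c) → mv c ≡ false

  MovesIfNoClosingRight : Set
  MovesIfNoClosingRight = ∀ c → Opening B i c → (∀ d → c < d → ¬ Closing B i d) → mv c ≡ true

  ballot-preserved-at-i : ∀ K → suc i ≤ K → MovesLeftward → BallotUpTo K B → ∀ c →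
    colPrefix B (suc (suc c)) i + bit (mv (suc (suc c))) ≤ colPrefix B (suc c) i + bit (mv (suc c))
  ballot-preserved-at-i K i<K leftward ballot c = go (mv q) (mv p) refl refl
    where
    p q : ℕ
    p = suc c
    q = suc (suc c)
    P : ℕ → ℕ → ℕ
    P = colPrefix B
    open ≤-Reasoning
    go : ∀ u v → mv q ≡ u → mv p ≡ v → P q i + bit u ≤ P p i + bit v
    go false v _ _ = begin
      P q i + 0     ≡⟨ +-identityʳ _ ⟩
      P q i         ≤⟨ ballot i c (<⇒≤ i<K) ⟩
      P p i         ≤⟨ m≤m+n _ _ ⟩
      P p i + bit v ∎
    go true true  _ _ = +-monoˡ-≤ 1 (ballot i c (<⇒≤ i<K))
    go true false mv-q mv-p = go′ (B i p) (B (suc i) p) refl refl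
      where
      q-opening : Opening B i q
      q-opening = mv⇒opening q mv-q
      go′ : ∀ a b → B i p ≡ a → B (suc i) p ≡ b → P q i + 1 ≤ P p i + 0
      go′ true _ ball-p _ = begin
        P q i + 1
          ≡⟨ cong (_+ 1) (trans (colPrefix-pred B q 1≤i) (cong (λ b → P q (pred i) + bit b) (proj₂ q-opening))) ⟩
        P q (pred i) + 0 + 1 ≡⟨ cong (_+ 1) (+-identityʳ _) ⟩
        P q (pred i) + 1     ≤⟨ +-monoˡ-≤ 1 (ballot (pred i) c (≤-trans pred[n]≤n (<⇒≤ i<K))) ⟩
        P p (pred i) + 1     ≡⟨ trans (colPrefix-pred B p 1≤i) (cong (λ b → P p (pred i) + bit b) ball-p) ⟨
        P p i                ≡⟨ +-identityʳ _ ⟨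
        P p i + 0            ∎
      go′ false true  empty-p full-p = ⊥-elim (true≢false (trans (sym (leftward p (s≤s z≤n) (full-p , empty-p) q-opening mv-q)) mv-p))
      go′ false false _       empty-p = begin
        P q i + 1            ≡⟨ cong (λ b → P q i + bit b) (proj₁ q-opening) ⟨
        P q (suc i)          ≤⟨ ballot (suc i) c i<K ⟩
        P p (suc i)          ≡⟨ cong (λ b → P p i + bit b) empty-p ⟩
        P p i + 0            ∎

  ballot-preserved : ∀ K → suc i ≤ K → MovesLeftward → BallotUpTo K B → BallotUpTo K B′
  ballot-preserved K i<K leftward ballot r c r≤K with r ≟ i
  ... | no r≢i   = subst₂ _≤_ (sym (colPrefix-unmoved (suc (suc c)) r≢i)) (sym (colPrefix-unmoved (suc c) r≢i)) (ballot r c r≤K)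
  ... | yes refl = subst₂ _≤_ (sym (colPrefix-at (suc (suc c)))) (sym (colPrefix-at (suc c)))
                     (ballot-preserved-at-i K i<K leftward ballot c)

  ballot-reflected-at-i : ∀ K → suc i ≤ K → StaysBeforeClosing → BallotUpTo K B′ → ∀ c →
    colPrefix B (suc (suc c)) i ≤ colPrefix B (suc c) i
  ballot-reflected-at-i K i<K stays ballot′ c = go (mv p) refl
    where
    p q : ℕ
    p = suc c
    q = suc (suc c)
    P : ℕ → ℕ → ℕ
    P = colPrefix B
    open ≤-Reasoning
    ballot-unmoved : ∀ {r} → r ≢ i → r ≤ K → P q r ≤ P p r
    ballot-unmoved r≢i r≤K = subst₂ _≤_ (colPrefix-unmoved q r≢i) (colPrefix-unmoved p r≢i) (ballot′ _ c r≤K)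
    go : ∀ v → mv p ≡ v → P q i ≤ P p i
    go false mv-p = begin
      P q i                  ≤⟨ m≤m+n _ _ ⟩
      P q i + bit (mv q)     ≤⟨ subst₂ _≤_ (colPrefix-at q) (colPrefix-at p) (ballot′ i c (<⇒≤ i<K)) ⟩
      P p i + bit (mv p)     ≡⟨ cong (λ m → P p i + bit m) mv-p ⟩
      P p i + 0              ≡⟨ +-identityʳ _ ⟩
      P p i                  ∎
    go true mv-p = go′ (B i q) (B (suc i) q) refl refl
      where
      p-opening : Opening B i p
      p-opening = mv⇒opening p mv-p
      go′ : ∀ a b → B i q ≡ a → B (suc i) q ≡ b → P q i ≤ P p i
      go′ false _ empty-q _ = begin
        P q i                      ≡⟨ colPrefix-pred B q 1≤i ⟩
        P q (pred i) + bit (B i q) ≡⟨ cong (λ b → P q (pred i) + bit b) empty-q ⟩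
        P q (pred i) + 0           ≡⟨ +-identityʳ _ ⟩
        P q (pred i)               ≤⟨ ballot-unmoved (<⇒≢ (pred< 1≤i)) (≤-trans pred[n]≤n (<⇒≤ i<K)) ⟩
        P p (pred i)               ≡⟨ +-identityʳ _ ⟨
        P p (pred i) + 0           ≡⟨ cong (λ b → P p (pred i) + bit b) (proj₂ p-opening) ⟨
        P p (pred i) + bit (B i p) ≡⟨ colPrefix-pred B p 1≤i ⟨
        P p i                      ∎
      go′ true true  _ full-q = +-cancelʳ-≤ 1 _ _ (begin
        P q i + 1                  ≡⟨ cong (λ b → P q i + bit b) full-q ⟨
        P q (suc i)                ≤⟨ ballot-unmoved (>⇒≢ (n<1+n i)) i<K ⟩
        P p (suc i)                ≡⟨ cong (λ b → P p i + bit b) (proj₁ p-opening) ⟩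
        P p i + 1                  ∎)
      go′ true false full-q empty-q = ⊥-elim (true≢false (trans (sym mv-p) (stays p p-opening (full-q , empty-q))))

  ballot-reflected : ∀ K → suc i ≤ K → StaysBeforeClosing → BallotUpTo K B′ → BallotUpTo K B
  ballot-reflected K i<K stays ballot′ r c r≤K with r ≟ i
  ... | no r≢i   = subst₂ _≤_ (colPrefix-unmoved (suc (suc c)) r≢i) (colPrefix-unmoved (suc c) r≢i) (ballot′ r c r≤K)
  ... | yes refl = ballot-reflected-at-i K i<K stays ballot′ c

  -- An opening column c with a closing column d to its right is impossible: column d is full up
  -- to row i, so by the ballot condition column c would be full up to row i as well.
  all-openings-move : ∀ K → i ≤ K → BallotUpTo i B → JustifiedUpToHole K i B → (∀ r → B r 0 ≡ false) →
    MovesIfNoClosingRight → ∀ c → Opening B i c → mv c ≡ true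
  all-openings-move K i≤K ballot hole column-0-empty moves-if-no-closing-right c opening@(top , empty) =
    moves-if-no-closing-right c opening no-closing
    where
    1≤c : 1 ≤ c
    1≤c = n≢0⇒n>0 λ { refl → true≢false (trans (sym top) (column-0-empty (suc i))) }
    no-closing : ∀ d → c < d → ¬ Closing B i d
    no-closing d c<d (full , _) = <⇒≱ (colPrefix<-if-empty B c i 1≤i empty) (begin
      i                  ≡⟨ colPrefix-filled B d i (filled-below B d i justified-below-i full) ⟨
      colPrefix B d i    ≤⟨ ballot-chain i B ballot i ≤-refl c d 1≤c (<⇒≤ c<d) ⟩
      colPrefix B c i    ∎)
      where
      open ≤-Reasoning
      justified-below-i : ∀ r → 1 ≤ r → r < i → B (suc r) d ≡ true → B r d ≡ true
      justified-below-i r 1≤r r<i ball with hole d r 1≤r (≤-trans (<⇒≤ r<i) i≤K) ball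
      ... | inj₁ b         = b
      ... | inj₂ (r≡i , _) = ⊥-elim (<⇒≢ r<i r≡i)

  hole-unmoved : ∀ K → JustifiedUpToHole K i B → ∀ c r → 1 ≤ r → r ≤ K → r ≢ i → r ≢ suc i → suc r ≢ i →
                 B′ (suc r) c ≡ true → B′ r c ≡ true
  hole-unmoved K hole c r 1≤r r≤K r≢i r≢1+i 1+r≢i ball′
    with hole c r 1≤r r≤K (trans (sym (B′-other c 1+r≢i (r≢i ∘ suc-injective))) ball′)
  ... | inj₁ b         = trans (B′-other c r≢i r≢1+i) b
  ... | inj₂ (r≡i , _) = ⊥-elim (r≢i r≡i)

  hole-below-i : ∀ K → JustifiedUpToHole K i B → ∀ c r → 1 ≤ r → r ≤ K → suc r ≡ i → B′ (suc r) c ≡ true →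
                 B′ r c ≡ true ⊎ (r ≡ pred i × (r < K → B′ (suc (suc r)) c ≡ false))
  hole-below-i K hole c r 1≤r r≤K refl ball′ with B r c in ball-r
  ... | true  = inj₁ (trans (B′-other c (<⇒≢ (n<1+n r)) (<⇒≢ (<-trans (n<1+n r) (n<1+n (suc r))))) ball-r)
  ... | false = inj₂ (refl , λ _ → trans (B′-above c) (trans (cong (λ m → B (suc (suc r)) c ∧ not m) moves) (∧-zeroʳ _)))
    where
    empty-i : B (suc r) c ≡ false
    empty-i with B (suc r) c in full-i
    ... | false = refl
    ... | true with hole c r 1≤r r≤K full-i
    ...   | inj₁ full-r      = ⊥-elim (true≢false (trans (sym full-r) ball-r))
    ...   | inj₂ (r≡1+r , _) = ⊥-elim (<⇒≢ (n<1+n r) r≡1+r)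
    moves : mv c ≡ true
    moves = trans (cong (_∨ mv c) (sym empty-i)) (trans (sym (B′-at c)) ball′)

  hole-at-i : (∀ c → Opening B i c → mv c ≡ true) → ∀ c → B′ (suc i) c ≡ true → B′ i c ≡ true
  hole-at-i all-move c ball′ = trans (B′-at c) moved-or-full
    where
    stays : B (suc i) c ∧ not (mv c) ≡ true
    stays = trans (sym (B′-above c)) ball′
    moved-or-full : B i c ∨ mv c ≡ true
    moved-or-full with B i c in ball-i
    ... | true  = refl
    ... | false = all-move c (∧-true₁ stays , ball-i)

  hole-above-i : ∀ K → JustifiedUpToHole K i B → ∀ c → suc i ≤ K → B′ (suc (suc i)) c ≡ true → B′ (suc i) c ≡ true
  hole-above-i K hole c i<K ball′ = trans (B′-above c) stays
    where
    full-i+2 : B (suc (suc i)) c ≡ true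
    full-i+2 = trans (sym (B′-other c (>⇒≢ (<-trans (n<1+n i) (n<1+n (suc i)))) (>⇒≢ (n<1+n (suc i))))) ball′
    full-i+1 : B (suc i) c ≡ true
    full-i+1 with hole c (suc i) (s≤s z≤n) i<K full-i+2
    ... | inj₁ b           = b
    ... | inj₂ (1+i≡i , _) = ⊥-elim (<⇒≢ (n<1+n i) (sym 1+i≡i))
    stays : B (suc i) c ∧ not (mv c) ≡ true
    stays with mv c in mv-c
    ... | false = trans (∧-identityʳ _) full-i+1
    ... | true with hole c i 1≤i (<⇒≤ i<K) full-i+1
    ...   | inj₁ full-i          = ⊥-elim (true≢false (trans (sym full-i) (proj₂ (mv⇒opening c mv-c))))
    ...   | inj₂ (_ , i+2-empty) = ⊥-elim (true≢false (trans (sym full-i+2) (i+2-empty i<K)))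

  hole-step : ∀ K → JustifiedUpToHole K i B → (∀ c → Opening B i c → mv c ≡ true) → JustifiedUpToHole K (pred i) B′
  hole-step K hole all-move c r 1≤r r≤K ball′ with <-cmp r i
  ... | tri≈ _ refl _ = inj₁ (hole-at-i all-move c ball′)
  ... | tri< r<i _ _ with m≤n⇒m<n∨m≡n r<i
  ...   | inj₂ 1+r≡i = hole-below-i K hole c r 1≤r r≤K 1+r≡i ball′
  ...   | inj₁ 1+r<i = inj₁ (hole-unmoved K hole c r 1≤r r≤K (<⇒≢ r<i) (<⇒≢ (<-trans r<i (n<1+n i))) (<⇒≢ 1+r<i) ball′)
  hole-step K hole all-move c r 1≤r r≤K ball′ | tri> _ _ i<r with m≤n⇒m<n∨m≡n i<r
  ...   | inj₂ refl  = inj₁ (hole-above-i K hole c r≤K ball′)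
  ...   | inj₁ 1+i<r = inj₁ (hole-unmoved K hole c r 1≤r r≤K (>⇒≢ i<r) (>⇒≢ 1+i<r)
                                         (>⇒≢ (<-trans i<r (n<1+n r))) ball′)

-- The bracket matching behind e_i^⋆

concatFrom : {A : Set} → (ℕ → List A) → ℕ → ℕ → List A
concatFrom G a zero    = []
concatFrom G a (suc m) = G a ++ concatFrom G (suc a) m

concatDown : {A : Set} → (ℕ → List A) → ℕ → List A
concatDown F zero    = []
concatDown F (suc h) = F h ++ concatDown F h

concatFrom-suc : ∀ {A : Set} (G : ℕ → List A) a m → concatFrom G a (suc m) ≡ concatFrom G a m ++ G (a + m)
concatFrom-suc G a zero    = trans (++-identityʳ (G a)) (cong G (sym (+-identityʳ a)))
concatFrom-suc G a (suc m) = begin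
  G a ++ concatFrom G (suc a) (suc m)        ≡⟨ cong (G a ++_) (concatFrom-suc G (suc a) m) ⟩
  G a ++ (concatFrom G (suc a) m ++ G (suc a + m)) ≡⟨ ++-assoc (G a) _ _ ⟨
  concatFrom G a (suc m) ++ G (suc a + m)    ≡⟨ cong (λ k → concatFrom G a (suc m) ++ G k) (+-suc a m) ⟨
  concatFrom G a (suc m) ++ G (a + suc m)    ∎
  where open ≡-Reasoning

concatFrom-+ : ∀ {A : Set} (G : ℕ → List A) a m k → concatFrom G a (m + k) ≡ concatFrom G a m ++ concatFrom G (a + m) k
concatFrom-+ G a zero    k = cong (λ b → concatFrom G b k) (sym (+-identityʳ a))
concatFrom-+ G a (suc m) k = begin
  G a ++ concatFrom G (suc a) (m + k)                         ≡⟨ cong (G a ++_) (concatFrom-+ G (suc a) m k) ⟩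
  G a ++ (concatFrom G (suc a) m ++ concatFrom G (suc a + m) k) ≡⟨ ++-assoc (G a) _ _ ⟨
  concatFrom G a (suc m) ++ concatFrom G (suc a + m) k
    ≡⟨ cong (λ b → concatFrom G a (suc m) ++ concatFrom G b k) (+-suc a m) ⟨
  concatFrom G a (suc m) ++ concatFrom G (a + suc m) k        ∎
  where open ≡-Reasoning

concatDown-suc : ∀ {A : Set} (F : ℕ → List A) h → concatDown F (suc h) ≡ concatDown (F ∘ suc) h ++ F 0
concatDown-suc F zero    = ++-identityʳ (F 0)
concatDown-suc F (suc h) = trans (cong (F (suc h) ++_) (concatDown-suc F h)) (sym (++-assoc (F (suc h)) _ (F 0)))

concatMap-tabulate : ∀ {A X : Set} n a (f : Fin n → X) (G : X → List A) (F : ℕ → List A) →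
                     (∀ c → G (f c) ≡ F (a + toℕ c)) → concatMap G (List.tabulate f) ≡ concatFrom F a n
concatMap-tabulate zero    a f G F eq = refl
concatMap-tabulate (suc n) a f G F eq = cong₂ _++_ (trans (eq fzero) (cong F (+-identityʳ a)))
  (concatMap-tabulate n (suc a) (f ∘ fsuc) G F (λ c → trans (eq (fsuc c)) (cong F (+-suc a (toℕ c)))))

concatMap-reverse-tabulate : ∀ {A X : Set} n (f : Fin n → X) (G : X → List A) (F : ℕ → List A) →
                             (∀ c → G (f c) ≡ F (toℕ c)) → concatMap G (reverse (List.tabulate f)) ≡ concatDown F n
concatMap-reverse-tabulate zero    f G F eq = refl
concatMap-reverse-tabulate (suc n) f G F eq = begin
  concatMap G (reverse (f fzero ∷ List.tabulate (f ∘ fsuc)))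
    ≡⟨ cong (concatMap G) (unfold-reverse (f fzero) (List.tabulate (f ∘ fsuc))) ⟩
  concatMap G (reverse (List.tabulate (f ∘ fsuc)) ++ f fzero ∷ [])      ≡⟨ concatMap-++ G (reverse (List.tabulate (f ∘ fsuc))) _ ⟩
  concatMap G (reverse (List.tabulate (f ∘ fsuc))) ++ (G (f fzero) ++ []) ≡⟨ cong₂ _++_ ih (trans (++-identityʳ _) (eq fzero)) ⟩
  concatDown (F ∘ suc) n ++ F 0                                        ≡⟨ concatDown-suc F n ⟨
  concatDown F (suc n)                                                 ∎
  where
  open ≡-Reasoning
  ih : concatMap G (reverse (List.tabulate (f ∘ fsuc))) ≡ concatDown (F ∘ suc) n
  ih = concatMap-reverse-tabulate n (f ∘ fsuc) G (F ∘ suc) (eq ∘ fsuc)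

-- State of the right-to-left matching of Par_i: the columns of the unmatched "(" found so far,
-- and the number of ")" still waiting for a partner.
Scan : Set
Scan = List ℕ × ℕ

scanStep : ℕ → Paren → Scan → Scan
scanStep c opn (cs , zero)  = c ∷ cs , zero
scanStep c opn (cs , suc k) = cs , k
scanStep c cls (cs , k)     = cs , suc k
scanStep c oth s            = s

scanTagged : ℕ → List (ℕ × ℕ) → Scan → Scan
scanTagged i []              s = s
scanTagged i ((r , c) ∷ rcs) s = scanStep c (parOf i r) (scanTagged i rcs s)

scanTagged-++ : ∀ i rcs rcs′ s → scanTagged i (rcs ++ rcs′) s ≡ scanTagged i rcs (scanTagged i rcs′ s)
scanTagged-++ i []              rcs′ s = refl
scanTagged-++ i ((r , c) ∷ rcs) rcs′ s = cong (scanStep c (parOf i r)) (scanTagged-++ i rcs rcs′ s)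

flagStep : Paren → List Bool × ℕ → List Bool × ℕ
flagStep opn (f , zero)  = true ∷ f , zero
flagStep opn (f , suc k) = false ∷ f , k
flagStep cls (f , k)     = false ∷ f , suc k
flagStep oth (f , k)     = false ∷ f , k

unmatchedOpen-∷ : ∀ p w → unmatchedOpen (p ∷ w) ≡ flagStep p (unmatchedOpen w)
unmatchedOpen-∷ opn w with unmatchedOpen w
... | f , zero  = refl
... | f , suc k = refl
unmatchedOpen-∷ cls w with unmatchedOpen w
... | f , k = refl
unmatchedOpen-∷ oth w with unmatchedOpen w
... | f , k = refl

parens : ℕ → List (ℕ × ℕ) → List Paren
parens i = List.map (λ p → parOf i (proj₁ p))

mutual
  -- The local helper of unmatchedCols cannot be named outside Defs; this metavariable is solved to it
  -- by unification, which needs the two list arguments abstracted by the with below.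
  selectFlagged : ∀ {L n} → ℕ → MLQ L n → List (ℕ × ℕ) → List Bool → List ℕ
  selectFlagged i M = _

  unmatchedCols-select : ∀ {L n} i (M : MLQ L n) →
    unmatchedCols i M ≡ selectFlagged i M (cwTagged M) (proj₁ (unmatchedOpen (parens i (cwTagged M))))
  unmatchedCols-select i M with cwTagged M | proj₁ (unmatchedOpen (parens i (cwTagged M)))
  ... | rcs | flags = refl

module _ {L n : ℕ} (i : ℕ) (M : MLQ L n) where

  select-scan : ∀ rcs → let u = unmatchedOpen (parens i rcs) in
                (selectFlagged i M rcs (proj₁ u) , proj₂ u) ≡ scanTagged i rcs ([] , 0)
  select-scan []              = refl
  select-scan ((r , c) ∷ rcs) =
    trans (cong (λ u → selectFlagged i M ((r , c) ∷ rcs) (proj₁ u) , proj₂ u) (unmatchedOpen-∷ (parOf i r) (parens i rcs)))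
          (trans (step (parOf i r) (unmatchedOpen (parens i rcs))) (cong (scanStep c (parOf i r)) (select-scan rcs)))
    where
    step : ∀ p u → (selectFlagged i M ((r , c) ∷ rcs) (proj₁ (flagStep p u)) , proj₂ (flagStep p u))
                   ≡ scanStep c p (selectFlagged i M rcs (proj₁ u) , proj₂ u)
    step opn (f , zero)  = refl
    step opn (f , suc k) = refl
    step cls (f , k)     = refl
    step oth (f , k)     = refl

  unmatchedCols-scan : unmatchedCols i M ≡ proj₁ (scanTagged i (cwTagged M) ([] , 0))
  unmatchedCols-scan = trans (unmatchedCols-select i M) (cong proj₁ (select-scan (cwTagged M)))

parOf-opn : ∀ i → parOf i (suc i) ≡ opn
parOf-opn i rewrite ≡ᵇ-true {i} refl = refl

parOf-cls : ∀ i → parOf i i ≡ cls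
parOf-cls i rewrite ≡ᵇ-false {i} {suc i} (<⇒≢ (n<1+n i)) | ≡ᵇ-true {i} refl = refl

parOf-oth : ∀ {i r} → r ≢ suc i → r ≢ i → parOf i r ≡ oth
parOf-oth r≢1+i r≢i rewrite ≡ᵇ-false r≢1+i | ≡ᵇ-false r≢i = refl

-- Read top to bottom, a column with balls in both rows i + 1 and i gives "()", which matches itself.
columnType : Bool → Bool → Paren
columnType false true  = opn
columnType true  false = cls
columnType _     _     = oth

module ColumnScan (c : ℕ) (f : ℕ → Bool) where

  cell : ℕ → List (ℕ × ℕ)
  cell r = if f (suc r) then (suc r , c) ∷ [] else []

  scan-cell : ∀ i r s → scanTagged i (cell r) s ≡ (if f (suc r) then scanStep c (parOf i (suc r)) s else s)
  scan-cell i r s with f (suc r)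
  ... | true  = refl
  ... | false = refl

  scan-cell-oth : ∀ i r s → suc r ≢ suc i → suc r ≢ i → scanTagged i (cell r) s ≡ s
  scan-cell-oth i r s r≢1+i r≢i with f (suc r)
  ... | true  rewrite parOf-oth r≢1+i r≢i = refl
  ... | false = refl

  scan-below : ∀ i h s → h < i → scanTagged i (concatDown cell h) s ≡ s
  scan-below i zero    s _   = refl
  scan-below i (suc h) s h<i = begin
    scanTagged i (cell h ++ concatDown cell h) s          ≡⟨ scanTagged-++ i (cell h) _ s ⟩
    scanTagged i (cell h) (scanTagged i (concatDown cell h) s)
      ≡⟨ cong (scanTagged i (cell h)) (scan-below i h s (<-trans (n<1+n h) h<i)) ⟩
    scanTagged i (cell h) s                                ≡⟨ scan-cell-oth i h s (<⇒≢ (<-trans h<i (n<1+n i))) (<⇒≢ h<i) ⟩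
    s                                                      ∎
    where open ≡-Reasoning

  scan-above : ∀ i k s → scanTagged i (concatDown cell (k + suc i)) s ≡ scanTagged i (concatDown cell (suc i)) s
  scan-above i zero    s = refl
  scan-above i (suc k) s = begin
    scanTagged i (cell (k + suc i) ++ concatDown cell (k + suc i)) s         ≡⟨ scanTagged-++ i (cell (k + suc i)) _ s ⟩
    scanTagged i (cell (k + suc i)) (scanTagged i (concatDown cell (k + suc i)) s)
      ≡⟨ scan-cell-oth i (k + suc i) _ (>⇒≢ i<r) (>⇒≢ (<-trans (n<1+n i) i<r)) ⟩
    scanTagged i (concatDown cell (k + suc i)) s                              ≡⟨ scan-above i k s ⟩
    scanTagged i (concatDown cell (suc i)) s                                  ∎
    where
    open ≡-Reasoning
    i<r : suc i < suc (k + suc i)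
    i<r = s≤s (m≤n+m (suc i) k)

  scan-rows : ∀ j s → scanTagged (suc j) (cell (suc j)) (scanTagged (suc j) (cell j) s)
                      ≡ scanStep c (columnType (f (suc j)) (f (suc (suc j)))) s
  scan-rows j (cs , k) rewrite scan-cell (suc j) j (cs , k) | parOf-cls (suc j) with f (suc j)
  ... | true  rewrite scan-cell (suc j) (suc j) (cs , suc k) | parOf-opn (suc j) with f (suc (suc j))
  ...   | true  = refl
  ...   | false = refl
  scan-rows j (cs , k) | false rewrite scan-cell (suc j) (suc j) (cs , k) | parOf-opn (suc j) with f (suc (suc j))
  ...   | true  = refl
  ...   | false = refl

  scan-column : ∀ i h s → 1 ≤ i → suc i ≤ h → scanTagged i (concatDown cell h) s ≡ scanStep c (columnType (f i) (f (suc i))) s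
  scan-column (suc j) h s _ i<h = begin
    scanTagged (suc j) (concatDown cell h) s
      ≡⟨ cong (λ h → scanTagged (suc j) (concatDown cell h) s) (m∸n+n≡m i<h) ⟨
    scanTagged (suc j) (concatDown cell (h ∸ suc (suc j) + suc (suc j))) s ≡⟨ scan-above (suc j) (h ∸ suc (suc j)) s ⟩
    scanTagged (suc j) (cell (suc j) ++ cell j ++ concatDown cell j) s ≡⟨ scanTagged-++ (suc j) (cell (suc j)) _ s ⟩
    scanTagged (suc j) (cell (suc j)) (scanTagged (suc j) (cell j ++ concatDown cell j) s)
      ≡⟨ cong (scanTagged (suc j) (cell (suc j))) (scanTagged-++ (suc j) (cell j) _ s) ⟩
    scanTagged (suc j) (cell (suc j)) (scanTagged (suc j) (cell j) (scanTagged (suc j) (concatDown cell j) s))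
      ≡⟨ cong (λ s → scanTagged (suc j) (cell (suc j)) (scanTagged (suc j) (cell j) s)) (scan-below (suc j) j s ≤-refl) ⟩
    scanTagged (suc j) (cell (suc j)) (scanTagged (suc j) (cell j) s) ≡⟨ scan-rows j s ⟩
    scanStep c (columnType (f (suc j)) (f (suc (suc j)))) s          ∎
    where open ≡-Reasoning

column : ∀ {L n} → MLQ L n → ℕ → List (ℕ × ℕ)
column {L} M c = concatDown (ColumnScan.cell c (λ r → ball M r c)) L

cwTagged-columns : ∀ {L n} (M : MLQ L n) → cwTagged M ≡ concatFrom (column M) 1 n
cwTagged-columns {L} {n} M = concatMap-tabulate n 1 id _ (column M) λ c →
  concatMap-reverse-tabulate L id _ _ λ r →
    cong (λ b → if b then (suc (toℕ r) , suc (toℕ c)) ∷ [] else []) (lookup-ball M r c)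

scanColumns : (ℕ → Paren) → ℕ → ℕ → Scan → Scan
scanColumns T a zero    s = s
scanColumns T a (suc m) s = scanStep a (T a) (scanColumns T (suc a) m s)

scanTagged-concatFrom : ∀ i G T → (∀ c s → scanTagged i (G c) s ≡ scanStep c (T c) s) →
                        ∀ a m s → scanTagged i (concatFrom G a m) s ≡ scanColumns T a m s
scanTagged-concatFrom i G T eq a zero    s = refl
scanTagged-concatFrom i G T eq a (suc m) s = begin
  scanTagged i (G a ++ concatFrom G (suc a) m) s            ≡⟨ scanTagged-++ i (G a) _ s ⟩
  scanTagged i (G a) (scanTagged i (concatFrom G (suc a) m) s) ≡⟨ eq a _ ⟩
  scanStep a (T a) (scanTagged i (concatFrom G (suc a) m) s)
    ≡⟨ cong (scanStep a (T a)) (scanTagged-concatFrom i G T eq (suc a) m s) ⟩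
  scanStep a (T a) (scanColumns T (suc a) m s)              ∎
  where open ≡-Reasoning

found : (ℕ → Paren) → ℕ → ℕ → List ℕ
found T a m = proj₁ (scanColumns T a m ([] , 0))

pending : (ℕ → Paren) → ℕ → ℕ → ℕ
pending T a m = proj₂ (scanColumns T a m ([] , 0))

isOpn : Paren → Bool
isOpn opn = true
isOpn _   = false

pendingStep : Paren → ℕ → ℕ
pendingStep opn zero    = zero
pendingStep opn (suc k) = k
pendingStep cls k       = suc k
pendingStep oth k       = k

unmatchedAt : (ℕ → Paren) → ℕ → ℕ → Bool
unmatchedAt T a m = isOpn (T a) ∧ (pending T (suc a) m ≡ᵇ 0)

found-suc : ∀ T a m → found T a (suc m) ≡ (if unmatchedAt T a m then a ∷ found T (suc a) m else found T (suc a) m)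
found-suc T a m with T a | scanColumns T (suc a) m ([] , 0)
... | opn | _ , zero  = refl
... | opn | _ , suc _ = refl
... | cls | _         = refl
... | oth | _         = refl

pending-suc : ∀ T a m → pending T a (suc m) ≡ pendingStep (T a) (pending T (suc a) m)
pending-suc T a m with T a | scanColumns T (suc a) m ([] , 0)
... | opn | _ , zero  = refl
... | opn | _ , suc _ = refl
... | cls | _         = refl
... | oth | _         = refl

memb-skip : ∀ b {a c} cs → a ≢ c → memb c (if b then a ∷ cs else cs) ≡ memb c cs
memb-skip true  cs a≢c rewrite ≡ᵇ-false a≢c = refl
memb-skip false cs _   = refl

memb-here : ∀ b {a} cs → memb a cs ≡ false → memb a (if b then a ∷ cs else cs) ≡ b
memb-here true  {a} cs _ rewrite ≡ᵇ-true {a} refl = refl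
memb-here false     cs a∉cs = a∉cs

memb-found-< : ∀ T a m c → c < a → memb c (found T a m) ≡ false
memb-found-< T a zero    c c<a = refl
memb-found-< T a (suc m) c c<a = trans (cong (memb c) (found-suc T a m))
  (trans (memb-skip (unmatchedAt T a m) (found T (suc a) m) (>⇒≢ c<a)) (memb-found-< T (suc a) m c (m<n⇒m<1+n c<a)))

memb-found-≥ : ∀ T a m c → a + m ≤ c → memb c (found T a m) ≡ false
memb-found-≥ T a zero    c _     = refl
memb-found-≥ T a (suc m) c a+m≤c = trans (cong (memb c) (found-suc T a m))
  (trans (memb-skip (unmatchedAt T a m) (found T (suc a) m) (<⇒≢ (≤-trans (s≤s (m≤m+n a m)) 1+a+m≤c)))
         (memb-found-≥ T (suc a) m c 1+a+m≤c))
  where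
  1+a+m≤c : suc a + m ≤ c
  1+a+m≤c = subst (_≤ c) (+-suc a m) a+m≤c

memb-found : ∀ T a m c → a ≤ c → c < a + m → memb c (found T a m) ≡ unmatchedAt T c (a + m ∸ suc c)
memb-found T a zero    c a≤c c<a = ⊥-elim (<⇒≱ c<a (subst (_≤ c) (sym (+-identityʳ a)) a≤c))
memb-found T a (suc m) c a≤c c<a+m with m≤n⇒m<n∨m≡n a≤c
... | inj₂ refl = begin
  memb a (found T a (suc m))                                  ≡⟨ cong (memb a) (found-suc T a m) ⟩
  memb a (if unmatchedAt T a m then a ∷ found T (suc a) m else found T (suc a) m)
                                                              ≡⟨ memb-here (unmatchedAt T a m) (found T (suc a) m) (memb-found-< T (suc a) m a ≤-refl) ⟩
  unmatchedAt T a m                                           ≡⟨ cong (unmatchedAt T a) index ⟨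
  unmatchedAt T a (a + suc m ∸ suc a)                         ∎
  where
  open ≡-Reasoning
  index : a + suc m ∸ suc a ≡ m
  index = trans (cong (_∸ suc a) (+-suc a m)) (m+n∸m≡n a m)
... | inj₁ a<c = begin
  memb c (found T a (suc m))                                  ≡⟨ cong (memb c) (found-suc T a m) ⟩
  memb c (if unmatchedAt T a m then a ∷ found T (suc a) m else found T (suc a) m)
                                                              ≡⟨ memb-skip (unmatchedAt T a m) (found T (suc a) m) (<⇒≢ a<c) ⟩
  memb c (found T (suc a) m)                                  ≡⟨ memb-found T (suc a) m c a<c (subst (c <_) (+-suc a m) c<a+m) ⟩
  unmatchedAt T c (suc a + m ∸ suc c)                         ≡⟨ cong (λ k → unmatchedAt T c (k ∸ suc c)) (+-suc a m) ⟨
  unmatchedAt T c (a + suc m ∸ suc c)                         ∎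
  where open ≡-Reasoning

moved : ∀ {L n} → ℕ → MLQ L n → ℕ → Bool
moved i M c = memb c (unmatchedCols i M)

module EStar {L n : ℕ} (i : ℕ) (M : MLQ L n) (1≤i : 1 ≤ i) (i<L : suc i ≤ L) where

  type : ℕ → Paren
  type c = columnType (ball M i c) (ball M (suc i) c)

  closersRight : ℕ → ℕ
  closersRight c = pending type (suc c) (n ∸ c)

  unmatchedCols-found : unmatchedCols i M ≡ found type 1 n
  unmatchedCols-found = begin
    unmatchedCols i M                                      ≡⟨ unmatchedCols-scan i M ⟩
    proj₁ (scanTagged i (cwTagged M) ([] , 0))
      ≡⟨ cong (λ rcs → proj₁ (scanTagged i rcs ([] , 0))) (cwTagged-columns M) ⟩
    proj₁ (scanTagged i (concatFrom (column M) 1 n) ([] , 0))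
      ≡⟨ cong proj₁ (scanTagged-concatFrom i (column M) type scan-column 1 n _) ⟩
    found type 1 n                                         ∎
    where
    open ≡-Reasoning
    scan-column : ∀ c s → scanTagged i (column M c) s ≡ scanStep c (type c) s
    scan-column c s = ColumnScan.scan-column c (λ r → ball M r c) i L s 1≤i i<L

  moved-outside : ∀ {c} → ¬ InRange n c → moved i M c ≡ false
  moved-outside {c} c∉ with 1 ≤? c
  ... | no c<1 = trans (cong (memb c) unmatchedCols-found) (memb-found-< type 1 n c (≰⇒> c<1))
  ... | yes 1≤c with c ≤? n
  ...   | yes c≤n = ⊥-elim (c∉ (1≤c , c≤n))
  ...   | no c>n = trans (cong (memb c) unmatchedCols-found) (memb-found-≥ type 1 n c (≰⇒> c>n))

  moved-inside : ∀ {c} → InRange n c → moved i M c ≡ isOpn (type c) ∧ (closersRight c ≡ᵇ 0)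
  moved-inside {c} (1≤c , c≤n) = trans (cong (memb c) unmatchedCols-found) (memb-found type 1 n c 1≤c (s≤s c≤n))

  closersRight-suc : ∀ {c} → c < n → closersRight c ≡ pendingStep (type (suc c)) (closersRight (suc c))
  closersRight-suc {c} c<n rewrite +-∸-assoc 1 c<n = pending-suc type (suc c) (n ∸ suc c)

  closersRight-last : closersRight n ≡ 0
  closersRight-last rewrite n∸n≡0 n = refl

  type-opn⇒opening : ∀ {c} → type c ≡ opn → Opening (ball M) i c
  type-opn⇒opening {c} t with ball M i c | ball M (suc i) c
  ... | false | true  = refl , refl
  type-opn⇒opening () | true  | true
  type-opn⇒opening () | true  | false
  type-opn⇒opening () | false | false

  type-cls⇒closing : ∀ {c} → type c ≡ cls → Closing (ball M) i c
  type-cls⇒closing {c} t with ball M i c | ball M (suc i) c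
  ... | true  | false = refl , refl
  type-cls⇒closing () | true  | true
  type-cls⇒closing () | false | true
  type-cls⇒closing () | false | false

  opening⇒type : ∀ {c} → Opening (ball M) i c → type c ≡ opn
  opening⇒type (e₁ , e₂) rewrite e₁ | e₂ = refl

  closing⇒type : ∀ {c} → Closing (ball M) i c → type c ≡ cls
  closing⇒type (e₁ , e₂) rewrite e₁ | e₂ = refl

  moved⇒ : ∀ {c} → moved i M c ≡ true → InRange n c × type c ≡ opn × closersRight c ≡ 0
  moved⇒ {c} e with inRange? n c
  ... | no c∉ = ⊥-elim (true≢false (trans (sym e) (moved-outside c∉)))
  ... | yes c∈ with type c | closersRight c | trans (sym (moved-inside c∈)) e
  ...   | opn | zero  | _  = c∈ , refl , refl
  ...   | opn | suc _ | ()
  ...   | cls | _     | ()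
  ...   | oth | _     | ()

  moved-if : ∀ {c} → InRange n c → type c ≡ opn → closersRight c ≡ 0 → moved i M c ≡ true
  moved-if c∈ t k = trans (moved-inside c∈) (cong₂ (λ p k → isOpn p ∧ (k ≡ᵇ 0)) t k)

  moved⇒opening : ∀ c → moved i M c ≡ true → Opening (ball M) i c
  moved⇒opening c e = type-opn⇒opening (proj₁ (proj₂ (moved⇒ e)))

  opening-inRange : ∀ {c} → Opening (ball M) i c → InRange n c
  opening-inRange {c} (e , _) = proj₂ (ball-inBox M (suc i) c e)

  moved-leftward : ∀ c → 1 ≤ c → Opening (ball M) i c → Opening (ball M) i (suc c) →
                   moved i M (suc c) ≡ true → moved i M c ≡ true
  moved-leftward c 1≤c open₁ open₂ e with moved⇒ e
  ... | (_ , c<n) , _ , none = moved-if (1≤c , <⇒≤ c<n) (opening⇒type open₁)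
    (trans (closersRight-suc c<n) (cong₂ pendingStep (opening⇒type open₂) none))

  not-moved-before-closing : ∀ c → Opening (ball M) i c → Closing (ball M) i (suc c) → moved i M c ≡ false
  not-moved-before-closing c opening closing@(e , _) = begin
    moved i M c                                                     ≡⟨ moved-inside (opening-inRange opening) ⟩
    isOpn (type c) ∧ (closersRight c ≡ᵇ 0)
      ≡⟨ cong (λ k → isOpn (type c) ∧ (k ≡ᵇ 0)) (closersRight-suc c<n) ⟩
    isOpn (type c) ∧ (pendingStep (type (suc c)) (closersRight (suc c)) ≡ᵇ 0)
      ≡⟨ cong (λ p → isOpn (type c) ∧ (pendingStep p (closersRight (suc c)) ≡ᵇ 0)) (closing⇒type closing) ⟩
    isOpn (type c) ∧ false                                          ≡⟨ ∧-zeroʳ _ ⟩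
    false                                                           ∎
    where
    open ≡-Reasoning
    c<n : c < n
    c<n = proj₂ (proj₂ (ball-inBox M i (suc c) e))

  moved-if-no-closing-right : ∀ c → Opening (ball M) i c → (∀ d → c < d → ¬ Closing (ball M) i d) → moved i M c ≡ true
  moved-if-no-closing-right c opening none =
    moved-if c∈ (opening⇒type opening) (closersRight-from (n ∸ c) c ≤-refl (m∸n+n≡m (proj₂ c∈)))
    where
    c∈ : InRange n c
    c∈ = opening-inRange opening
    pendingStep-0 : ∀ d → c < d → pendingStep (type d) 0 ≡ 0
    pendingStep-0 d c<d with type d in t
    ... | opn = refl
    ... | oth = refl
    ... | cls = ⊥-elim (none d c<d (type-cls⇒closing t))
    closersRight-from : ∀ k d → c ≤ d → k + d ≡ n → closersRight d ≡ 0
    closersRight-from zero    d c≤d refl = closersRight-last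
    closersRight-from (suc k) d c≤d k+d≡n = begin
      closersRight d                                         ≡⟨ closersRight-suc (≤-trans (s≤s (m≤n+m d k)) (≤-reflexive k+d≡n)) ⟩
      pendingStep (type (suc d)) (closersRight (suc d))
        ≡⟨ cong (pendingStep (type (suc d))) (closersRight-from k (suc d) (m≤n⇒m≤1+n c≤d) (trans (+-suc k d) k+d≡n)) ⟩
      pendingStep (type (suc d)) 0                           ≡⟨ pendingStep-0 (suc d) (s≤s c≤d) ⟩
      0                                                      ∎
      where open ≡-Reasoning

  estar-ball : ∀ r c → ball (estar i M) r c ≡ moveCell i r (ball M r c) (moved i M c)
  estar-ball r c with inRange? n c
  ... | no c∉ rewrite ball-outsideColumn (estar i M) r c∉ | ball-outsideColumn M r c∉ | moved-outside c∉ =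
    sym (moveCell-empty i r)
  ... | yes c∈ with inRange? L r
  ...   | no r∉ rewrite ball-outsideRow (estar i M) c r∉ | ball-outsideRow M c r∉ =
    sym (moveCell-other i {r} false (moved i M c) (λ { refl → r∉ (1≤i , <⇒≤ i<L) }) (λ { refl → r∉ (s≤s z≤n , i<L) }))
  ...   | yes r∈ with toFin r∈ | toFin c∈
  ...     | r′ , refl | c′ , refl = begin
    ball (estar i M) r c                                      ≡⟨ lookup-ball (estar i M) r′ c′ ⟨
    lookup (lookup (estar i M) r′) c′                         ≡⟨ lookup-tabulate² _ r′ c′ ⟩
    moveCell i r (lookup (lookup M r′) c′) (moved i M c)      ≡⟨ cong (λ b → moveCell i r b (moved i M c)) (lookup-ball M r′ c′) ⟩
    moveCell i r (ball M r c) (moved i M c)                   ∎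
    where open ≡-Reasoning

  open Move (ball M) (ball (estar i M)) i (moved i M) 1≤i estar-ball moved⇒opening public

-- The collapsing map ρ_N

≤∸1⇒< : ∀ {m n} → suc m ≤ n ∸ 1 → suc m < n
≤∸1⇒< {n = suc n} le = s≤s le

ballot-reflected-eInt : ∀ {L n} b (N : MLQ L n) → suc b ≤ L → BallotUpTo L (ball (eInt b N)) → BallotUpTo L (ball N)
ballot-reflected-eInt zero    N _   ballot = ballot
ballot-reflected-eInt {L} (suc b) N b<L ballot =
  S.ballot-reflected L b<L S.not-moved-before-closing (ballot-reflected-eInt b (estar (suc b) N) (<⇒≤ b<L) ballot)
  where module S = EStar (suc b) N (s≤s z≤n) b<L

ballot-reflected-rhoUpTo : ∀ {L n} k (M : MLQ L n) → k ≤ L ∸ 1 → BallotUpTo L (ball (rhoUpTo k M)) → BallotUpTo L (ball M)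
ballot-reflected-rhoUpTo zero    M _   ballot = ballot
ballot-reflected-rhoUpTo (suc k) M k<L ballot =
  ballot-reflected-rhoUpTo k M (<⇒≤ k<L) (ballot-reflected-eInt (suc k) (rhoUpTo k M) (≤∸1⇒< k<L) ballot)

Collapsed : ∀ {L n} → ℕ → MLQ L n → MLQ L n → Set
Collapsed {L} K N N₀ = BallotUpTo L (ball N) × JustifiedUpTo (suc K) (ball N) ×
                       (∀ c → colPrefix (ball N) c L ≡ colPrefix (ball N₀) c L)

collapse-eInt : ∀ {L n} K j (N : MLQ L n) → j ≤ K → suc K ≤ L →
                BallotUpTo L (ball N) → JustifiedUpToHole K j (ball N) → Collapsed K (eInt j N) N
collapse-eInt K zero    N _     _   ballot hole = ballot , holeAtZero⇒justified K (ball N) hole , λ _ → refl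
collapse-eInt {L} K (suc j) N 1+j≤K K<L ballot hole =
  let ballot″ , justified , same = collapse-eInt K j (estar (suc j) N) (<⇒≤ 1+j≤K) K<L ballot′ hole′
  in  ballot″ , justified , λ c → trans (same c) (S.colPrefix-unmoved c (>⇒≢ i<L))
  where
  i<L : suc (suc j) ≤ L
  i<L = ≤-trans (s≤s 1+j≤K) K<L
  module S = EStar (suc j) N (s≤s z≤n) i<L
  ballot′ : BallotUpTo L (ball (estar (suc j) N))
  ballot′ = S.ballot-preserved L i<L S.moved-leftward ballot
  column-0-empty : ∀ r → ball N r 0 ≡ false
  column-0-empty r = ball-outsideColumn N r λ { (() , _) }
  all-move : ∀ c → Opening (ball N) (suc j) c → moved (suc j) N c ≡ true
  all-move = S.all-openings-move K 1+j≤K (λ r c r≤i → ballot r c (≤-trans r≤i (<⇒≤ i<L))) hole column-0-empty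
               S.moved-if-no-closing-right
  hole′ : JustifiedUpToHole K j (ball (estar (suc j) N))
  hole′ = S.hole-step K hole all-move

collapse-rhoUpTo : ∀ {L n} k (M : MLQ L n) → k ≤ L ∸ 1 → BallotUpTo L (ball M) → Collapsed k (rhoUpTo k M) M
collapse-rhoUpTo zero    M _   ballot = ballot , (λ _ r 1≤r r<1 _ → ⊥-elim (<⇒≱ (s≤s 1≤r) r<1)) , λ _ → refl
collapse-rhoUpTo (suc k) M k<L ballot =
  let ballot′  , justified  , same  = collapse-rhoUpTo k M (<⇒≤ k<L) ballot
      ballot″ , justified′ , same′ = collapse-eInt (suc k) (suc k) (rhoUpTo k M) ≤-refl (≤∸1⇒< k<L) ballot′
                                        (justified⇒holeAtTop (suc k) _ justified)
  in  ballot″ , justified′ , λ c → trans (same′ c) (same c)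

-- Lattice words

countL-≢ : ∀ {j a} xs → a ≢ j → countL j (a ∷ xs) ≡ countL j xs
countL-≢ xs a≢j rewrite ≡ᵇ-false a≢j = refl

countL-≡ : ∀ j xs → countL j (j ∷ xs) ≡ suc (countL j xs)
countL-≡ j xs rewrite ≡ᵇ-true {j} refl = refl

countL-++ : ∀ j xs ys → countL j (xs ++ ys) ≡ countL j xs + countL j ys
countL-++ j xs ys = trans (cong length (filter-++ (λ a → a ≟ j) xs ys)) (length-++ (filter (λ a → a ≟ j) xs))

countL-take : ∀ j t xs → countL j (take t xs) ≤ countL j xs
countL-take j t xs = begin
  countL j (take t xs)                          ≤⟨ m≤m+n _ _ ⟩
  countL j (take t xs) + countL j (drop t xs)   ≡⟨ countL-++ j (take t xs) (drop t xs) ⟨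
  countL j (take t xs ++ drop t xs)             ≡⟨ cong (countL j) (take++drop≡id t xs) ⟩
  countL j xs                                   ∎
  where open ≤-Reasoning

take-++ : ∀ {A : Set} k (u v : List A) → take k (u ++ v) ≡ take k u ++ take (k ∸ length u) v
take-++ zero    []      v = refl
take-++ (suc k) []      v = refl
take-++ zero    (a ∷ u) v = refl
take-++ (suc k) (a ∷ u) v = cong (a ∷_) (take-++ k u v)

take-length-++ : ∀ {A : Set} (u v : List A) → take (length u) (u ++ v) ≡ u
take-length-++ []      v = refl
take-length-++ (a ∷ u) v = cong (a ∷_) (take-length-++ u v)

Lattice-[] : Lattice []
Lattice-[] zero    i = z≤n
Lattice-[] (suc k) i = z≤n

Lattice-++ : ∀ u v → Lattice u → (∀ t i → countL (suc (suc i)) (u ++ take t v) ≤ countL (suc i) (u ++ take t v)) →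
             Lattice (u ++ v)
Lattice-++ u v lattice-u prefixes k i rewrite take-++ k u v with k ≤? length u
... | yes k≤u rewrite m≤n⇒m∸n≡0 k≤u | ++-identityʳ (take k u) = lattice-u k i
... | no  k>u rewrite take-all k u (<⇒≤ (≰⇒> k>u)) = prefixes (k ∸ length u) i

letterIf : (ℕ → Bool) → ℕ → List ℕ
letterIf f c = if f c then c ∷ [] else []

module Letters (f : ℕ → Bool) where

  word : ℕ → ℕ → List ℕ
  word = concatFrom (letterIf f)

  countL-word-< : ∀ a m j → j < a → countL j (word a m) ≡ 0
  countL-word-< a zero    j j<a = refl
  countL-word-< a (suc m) j j<a with f a
  ... | true  = trans (countL-≢ (word (suc a) m) (>⇒≢ j<a)) (countL-word-< (suc a) m j (m<n⇒m<1+n j<a))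
  ... | false = countL-word-< (suc a) m j (m<n⇒m<1+n j<a)

  countL-word-≥ : ∀ a m j → a + m ≤ j → countL j (word a m) ≡ 0
  countL-word-≥ a zero    j _     = refl
  countL-word-≥ a (suc m) j a+m≤j with f a
  ... | true  = trans (countL-≢ (word (suc a) m) (<⇒≢ (≤-trans (s≤s (m≤m+n a m)) 1+a+m≤j)))
                      (countL-word-≥ (suc a) m j 1+a+m≤j)
    where
    1+a+m≤j : suc a + m ≤ j
    1+a+m≤j = subst (_≤ j) (+-suc a m) a+m≤j
  ... | false = countL-word-≥ (suc a) m j (subst (_≤ j) (+-suc a m) a+m≤j)

  countL-word : ∀ a m j → a ≤ j → j < a + m → countL j (word a m) ≡ bit (f j)
  countL-word a zero    j a≤j j<a = ⊥-elim (<⇒≱ j<a (subst (_≤ j) (sym (+-identityʳ a)) a≤j))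
  countL-word a (suc m) j a≤j j<a+m with m≤n⇒m<n∨m≡n a≤j
  ... | inj₂ refl with f a
  ...   | true  = trans (countL-≡ a (word (suc a) m)) (cong suc (countL-word-< (suc a) m a ≤-refl))
  ...   | false = countL-word-< (suc a) m a ≤-refl
  countL-word a (suc m) j a≤j j<a+m | inj₁ a<j with f a
  ...   | true  = trans (countL-≢ (word (suc a) m) (<⇒≢ a<j)) (countL-word (suc a) m j a<j (subst (j <_) (+-suc a m) j<a+m))
  ...   | false = countL-word (suc a) m j a<j (subst (j <_) (+-suc a m) j<a+m)

  -- Letters of a row word increase, so a prefix containing q contains every p < q of the row.
  countL-take-word : ∀ a m t p q → p < q → 1 ≤ countL q (take t (word a m)) →
                     countL p (take t (word a m)) ≡ countL p (word a m)
  countL-take-word a zero    t p q p<q has-q rewrite take-[] {A = ℕ} t = ⊥-elim (<⇒≱ has-q z≤n)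
  countL-take-word a (suc m) t p q p<q has-q with f a
  ... | false = countL-take-word (suc a) m t p q p<q has-q
  countL-take-word a (suc m) zero    p q p<q has-q | true = ⊥-elim (<⇒≱ has-q z≤n)
  countL-take-word a (suc m) (suc t) p q p<q has-q | true with a ≟ q | a ≟ p
  ... | yes refl | _ = begin
    countL p (a ∷ take t (word (suc a) m)) ≡⟨ countL-≢ _ a≢p ⟩
    countL p (take t (word (suc a) m))     ≡⟨ n≤0⇒n≡0 (≤-trans (countL-take p t _) (≤-reflexive no-p)) ⟩
    0                                      ≡⟨ no-p ⟨
    countL p (word (suc a) m)              ≡⟨ countL-≢ _ a≢p ⟨
    countL p (a ∷ word (suc a) m)          ∎
    where
    open ≡-Reasoning
    a≢p : a ≢ p
    a≢p e = <⇒≢ p<q (sym e)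
    no-p : countL p (word (suc a) m) ≡ 0
    no-p = countL-word-< (suc a) m p (m<n⇒m<1+n p<q)
  ... | no a≢q | yes refl = trans (countL-≡ a _) (trans (cong suc (countL-take-word (suc a) m t a q p<q has-q′)) (sym (countL-≡ a _)))
    where
    has-q′ : 1 ≤ countL q (take t (word (suc a) m))
    has-q′ = subst (1 ≤_) (countL-≢ _ a≢q) has-q
  ... | no a≢q | no a≢p = trans (countL-≢ _ a≢p) (trans (countL-take-word (suc a) m t p q p<q has-q′) (sym (countL-≢ _ a≢p)))
    where
    has-q′ : 1 ≤ countL q (take t (word (suc a) m))
    has-q′ = subst (1 ≤_) (countL-≢ _ a≢q) has-q

module ReadingWord {L n : ℕ} (M : MLQ L n) where

  rowWord : ℕ → List ℕ
  rowWord r = Letters.word (λ c → ball M r c) 1 n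

  rowsWord : ℕ → List ℕ
  rowsWord = concatFrom rowWord 1

  rw-rows : rw M ≡ rowsWord L
  rw-rows = concatMap-tabulate L 1 id _ rowWord λ r →
    concatMap-tabulate n 1 id _ (letterIf (λ c → ball M (suc (toℕ r)) c)) λ c →
      cong (λ b → if b then suc (toℕ c) ∷ [] else []) (lookup-ball M r c)

  countL-rowWord : ∀ r j → 1 ≤ j → countL j (rowWord r) ≡ bit (ball M r j)
  countL-rowWord r j 1≤j with j ≤? n
  ... | yes j≤n = Letters.countL-word (λ c → ball M r c) 1 n j 1≤j (s≤s j≤n)
  ... | no  j>n rewrite ball-outsideColumn M r (λ j∈ → j>n (proj₂ j∈)) =
    Letters.countL-word-≥ (λ c → ball M r c) 1 n j (≰⇒> j>n)

  countL-rowsWord : ∀ h j → 1 ≤ j → countL j (rowsWord h) ≡ colPrefix (ball M) j h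
  countL-rowsWord zero    j 1≤j = refl
  countL-rowsWord (suc h) j 1≤j = begin
    countL j (rowsWord (suc h))                        ≡⟨ cong (countL j) (concatFrom-suc rowWord 1 h) ⟩
    countL j (rowsWord h ++ rowWord (suc h))           ≡⟨ countL-++ j (rowsWord h) (rowWord (suc h)) ⟩
    countL j (rowsWord h) + countL j (rowWord (suc h)) ≡⟨ cong₂ _+_ (countL-rowsWord h j 1≤j) (countL-rowWord (suc h) j 1≤j) ⟩
    colPrefix (ball M) j (suc h)                       ∎
    where open ≡-Reasoning

  lattice⇒ballot : Lattice (rw M) → BallotUpTo L (ball M)
  lattice⇒ballot lattice r c r≤L =
    subst₂ _≤_ (countL-rowsWord r (suc (suc c)) (s≤s z≤n)) (countL-rowsWord r (suc c) (s≤s z≤n))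
      (subst (λ w → countL (suc (suc c)) w ≤ countL (suc c) w) prefix (lattice (length (rowsWord r)) c))
    where
    prefix : take (length (rowsWord r)) (rw M) ≡ rowsWord r
    prefix = begin
      take (length (rowsWord r)) (rw M)                                       ≡⟨ cong (take (length (rowsWord r))) rw-rows ⟩
      take (length (rowsWord r)) (rowsWord L)
        ≡⟨ cong (λ h → take (length (rowsWord r)) (rowsWord h)) (m+[n∸m]≡n r≤L) ⟨
      take (length (rowsWord r)) (rowsWord (r + (L ∸ r)))
        ≡⟨ cong (take (length (rowsWord r))) (concatFrom-+ rowWord 1 r (L ∸ r)) ⟩
      take (length (rowsWord r)) (rowsWord r ++ concatFrom rowWord (1 + r) (L ∸ r)) ≡⟨ take-length-++ (rowsWord r) _ ⟩
      rowsWord r                                                               ∎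
      where open ≡-Reasoning

  ballot⇒lattice-rows : BallotUpTo L (ball M) → ∀ h → h ≤ L → Lattice (rowsWord h)
  ballot⇒lattice-rows ballot zero    _   = Lattice-[]
  ballot⇒lattice-rows ballot (suc h) h<L = subst Lattice (sym (concatFrom-suc rowWord 1 h))
    (Lattice-++ (rowsWord h) (rowWord (suc h)) (ballot⇒lattice-rows ballot h (<⇒≤ h<L)) prefixes)
    where
    prefixes : ∀ t i → countL (suc (suc i)) (rowsWord h ++ take t (rowWord (suc h)))
                       ≤ countL (suc i) (rowsWord h ++ take t (rowWord (suc h)))
    prefixes t i = subst₂ _≤_ (sym (count (suc i))) (sym (count i)) (in-row (countL q (take t row)) refl)
      where
      p q : ℕ
      p = suc i
      q = suc (suc i)
      row : List ℕ
      row = rowWord (suc h)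
      P : ℕ → ℕ → ℕ
      P = colPrefix (ball M)
      open ≤-Reasoning
      count : ∀ j → countL (suc j) (rowsWord h ++ take t row) ≡ P (suc j) h + countL (suc j) (take t row)
      count j = trans (countL-++ (suc j) (rowsWord h) (take t row))
                      (cong (_+ countL (suc j) (take t row)) (countL-rowsWord h (suc j) (s≤s z≤n)))
      in-row : ∀ k → countL q (take t row) ≡ k → P q h + k ≤ P p h + countL p (take t row)
      in-row zero _ = begin
        P q h + 0                        ≡⟨ +-identityʳ _ ⟩
        P q h                            ≤⟨ ballot h i (<⇒≤ h<L) ⟩
        P p h                            ≤⟨ m≤m+n _ _ ⟩
        P p h + countL p (take t row)    ∎
      in-row (suc k) has-q = begin
        P q h + suc k                    ≡⟨ cong (P q h +_) has-q ⟨
        P q h + countL q (take t row)    ≤⟨ +-monoʳ-≤ (P q h) (countL-take q t row) ⟩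
        P q h + countL q row             ≡⟨ cong (P q h +_) (countL-rowWord (suc h) q (s≤s z≤n)) ⟩
        P q (suc h)                      ≤⟨ ballot (suc h) i h<L ⟩
        P p (suc h)                      ≡⟨ cong (P p h +_) (countL-rowWord (suc h) p (s≤s z≤n)) ⟨
        P p h + countL p row
          ≡⟨ cong (P p h +_) (Letters.countL-take-word (λ c → ball M (suc h) c) 1 n t p q (n<1+n p) q-in-prefix) ⟨
        P p h + countL p (take t row)    ∎
        where
        q-in-prefix : 1 ≤ countL q (take t row)
        q-in-prefix = subst (1 ≤_) (sym has-q) (s≤s z≤n)

  ballot⇒lattice : BallotUpTo L (ball M) → Lattice (rw M)
  ballot⇒lattice ballot = subst Lattice (sym rw-rows) (ballot⇒lattice-rows ballot L ≤-refl)

-- Conjugate partitions and M(λ′)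

IsPartition-tail : ∀ {a la} → IsPartition (a ∷ la) → IsPartition la
IsPartition-tail (one-part _)    = []-part
IsPartition-tail (cons-part _ p) = p

part≤head : ∀ {a la} → IsPartition (a ∷ la) → ∀ r → part la r ≤ a
part≤head {la = []}     _                 r             = z≤n
part≤head {la = b ∷ la} (cons-part b≤a p) zero          = z≤n
part≤head {la = b ∷ la} (cons-part b≤a p) (suc zero)    = b≤a
part≤head {la = b ∷ la} (cons-part b≤a p) (suc (suc r)) = ≤-trans (part≤head p (suc r)) b≤a

conj-beyond-head : ∀ {a la} c → IsPartition (a ∷ la) → a < c → conj la c ≡ 0
conj-beyond-head {la = []}     c _                 a<c = refl
conj-beyond-head {la = b ∷ la} c (cons-part b≤a p) a<c rewrite ≤ᵇ-false {c} {b} (≤-trans (s≤s b≤a) a<c) =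
  conj-beyond-head c p (≤-trans (s≤s b≤a) a<c)

conj-duality : ∀ {la} → IsPartition la → ∀ r c → 1 ≤ r → 1 ≤ c → (r ≤ᵇ conj la c) ≡ (c ≤ᵇ part la r)
conj-duality {[]}     _ r c 1≤r 1≤c = trans (≤ᵇ-false {r} {0} 1≤r) (sym (≤ᵇ-false {c} {0} 1≤c))
conj-duality {a ∷ la} p r c 1≤r 1≤c with c ≤? a
... | yes c≤a rewrite ≤ᵇ-true c≤a = row r 1≤r
  where
  row : ∀ r → 1 ≤ r → (r ≤ᵇ suc (conj la c)) ≡ (c ≤ᵇ part (a ∷ la) r)
  row (suc zero)    _ = sym (≤ᵇ-true c≤a)
  row (suc (suc r)) _ = conj-duality (IsPartition-tail p) (suc r) c (s≤s z≤n) 1≤c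
... | no c≰a rewrite ≤ᵇ-false (≰⇒> c≰a) | conj-beyond-head c p (≰⇒> c≰a) = row r 1≤r
  where
  row : ∀ r → 1 ≤ r → (r ≤ᵇ 0) ≡ (c ≤ᵇ part (a ∷ la) r)
  row (suc zero)    _ = sym (≤ᵇ-false (≰⇒> c≰a))
  row (suc (suc r)) _ = sym (≤ᵇ-false (≤-trans (s≤s (part≤head p (suc r))) (≰⇒> c≰a)))

Mconj-lookup : ∀ la L n r c → lookup (lookup (Mconj la L n) r) c ≡ (suc (toℕ c) ≤ᵇ part la (suc (toℕ r)))
Mconj-lookup la L n = lookup-tabulate² (λ r c → suc (toℕ c) ≤ᵇ part la (suc (toℕ r)))

Mconj-ball : ∀ la L n r c → InRange L r → InRange n c → ball (Mconj la L n) r c ≡ (c ≤ᵇ part la r)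
Mconj-ball la L n r c r∈ c∈ with toFin r∈ | toFin c∈
... | r′ , refl | c′ , refl = trans (sym (lookup-ball (Mconj la L n) r′ c′)) (Mconj-lookup la L n r′ c′)

Mconj-ballot : ∀ la L n → BallotUpTo L (ball (Mconj la L n))
Mconj-ballot la L n r c _ = colPrefix-mono (ball Mc) (suc c) (suc (suc c)) left-of r
  where
  Mc : MLQ L n
  Mc = Mconj la L n
  left-of : ∀ r → ball Mc r (suc (suc c)) ≡ true → ball Mc r (suc c) ≡ true
  left-of r e with ball-inBox Mc r (suc (suc c)) e
  ... | r∈ , c∈@(_ , c<n) = trans (Mconj-ball la L n r (suc c) r∈ (s≤s z≤n , <⇒≤ c<n))
    (≤ᵇ-true (<⇒≤ (≤ᵇ-true⇒≤ {suc (suc c)} {part la r} (trans (sym (Mconj-ball la L n r (suc (suc c)) r∈ c∈)) e))))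

justified-content⇒Mconj : ∀ {L n} (R : MLQ L n) la → IsPartition la → JustifiedUpTo L (ball R) →
  (∀ (c : Fin n) → colPrefix (ball R) (suc (toℕ c)) L ≡ conj la (suc (toℕ c))) → R ≡ Mconj la L n
justified-content⇒Mconj {L} {n} R la partition justified content = Vec-ext² R (Mconj la L n) λ r c → begin
  lookup (lookup R r) c                                   ≡⟨ lookup-ball R r c ⟩
  ball R (suc (toℕ r)) (suc (toℕ c))
    ≡⟨ justified-ball (ball R) (suc (toℕ c)) L justified (suc (toℕ r)) (s≤s z≤n) (toℕ<n r) ⟩
  (suc (toℕ r) ≤ᵇ colPrefix (ball R) (suc (toℕ c)) L)     ≡⟨ cong (suc (toℕ r) ≤ᵇ_) (content c) ⟩
  (suc (toℕ r) ≤ᵇ conj la (suc (toℕ c)))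
    ≡⟨ conj-duality partition (suc (toℕ r)) (suc (toℕ c)) (s≤s z≤n) (s≤s z≤n) ⟩
  (suc (toℕ c) ≤ᵇ part la (suc (toℕ r)))                  ≡⟨ Mconj-lookup la L n r c ⟨
  lookup (lookup (Mconj la L n) r) c                      ∎
  where open ≡-Reasoning

lemma4p23 : (la mu : List ℕ) (n : ℕ) → IsPartition la → IsPartition mu
    → (M : MLQ (first mu) n) → IsMLQ mu n M
    → (∀ (c : Fin n) → colCount M c ≡ conj la (suc (toℕ c)))
    → first la ≤ n
    → (rhoN M ≡ Mconj la (first mu) n) ⇔ Lattice (rw M)
lemma4p23 la mu n la-partition _ M _ content _ = mk⇔ collapsed⇒lattice lattice⇒collapsed
  where
  L : ℕ
  L = first mu
  collapsed⇒lattice : rhoN M ≡ Mconj la L n → Lattice (rw M)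
  collapsed⇒lattice ρM≡ = ReadingWord.ballot⇒lattice M (ballot-reflected-rhoUpTo (L ∸ 1) M ≤-refl
    (subst (λ N → BallotUpTo L (ball N)) (sym ρM≡) (Mconj-ballot la L n)))
  lattice⇒collapsed : Lattice (rw M) → rhoN M ≡ Mconj la L n
  lattice⇒collapsed lattice =
    let _ , justified , same = collapse-rhoUpTo (L ∸ 1) M ≤-refl (ReadingWord.lattice⇒ballot M lattice)
    in  justified-content⇒Mconj (rhoN M) la la-partition
          (λ c r 1≤r r<L → justified c r 1≤r (≤-trans r<L (m≤n+m∸n L 1)))
          (λ c → trans (same (suc (toℕ c))) (trans (sym (colCount-colPrefix M c)) (content c)))
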